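{- Let $\Sigma$ be a finite alphabet with $|\Sigma|>1$, $n\ge1$, and let $B\subset\mathcal{S}_n$ be a $(1,1)$-guaranteed subset. Then the bucketing function $f^2_B$ is $(3,5)$-sensitive.
   Context: $\mathcal{S}_n=\Sigma^n$ is the set of length-$n$ sequences over $\Sigma$ with the edit (Levenshtein) distance $\mathrm{edit}$ (minimum number of single-character insertions, deletions, substitutions). For $s\in\mathcal{S}_n$ and integer $d\ge0$, $N_n^d(s)=\{t\in\mathcal{S}_n:\mathrm{edit}(s,t)\le d\}$. A bucketing function with bucket set $B$ is a map $f:\mathcal{S}_n\to\mathcal{P}(B)$; it is $(d_1,d_2)$-sensitive ($d_1<d_2$ non-negative integers) if for all $s,t\in\mathcal{S}_n$: $\mathrm{edit}(s,t)\le d_1\Rightarrow f(s)\cap f(t)\neq\emptyset$ and $\mathrm{edit}(s,t)\ge d_2\Rightarrow f(s)\cap f(t)=\emptyset$. For $B\subset\mathcal{S}_n$ and integer $r\ge1$, $f^r_B:\mathcal{S}_n\to\mathcal{P}(B)$ is defined by $f^r_B(s)=N_n^r(s)\cap B$. A subset $B\subset\mathcal{S}_n$ is $(d_1,r)$-guaranteed if $N_n^r(s)\cap N_n^r(t)\cap B\neq\emptyset$ for every pair $s,t\in\mathcal{S}_n$ with $\mathrm{edit}(s,t)\le d_1$. -}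

module Defs where

open import Data.Nat using (ℕ; zero; suc; _+_; _≤_; _⊓_)
open import Data.Fin using (Fin)
open import Data.Fin.Properties using (_≟_)
open import Data.List using (List; []; _∷_; length)
open import Data.Vec using (Vec; toList)
open import Data.Product using (Σ; _×_; ∃)
open import Relation.Nullary using (¬_; yes; no)

-- Alphabet Σ = Fin q (any finite alphabet of size q).
-- Levenshtein distance on lists, by the standard recursion.
subCost : ∀ {q} → Fin q → Fin q → ℕ
subCost x y with x ≟ y
... | yes _ = 0
... | no  _ = 1

editL : ∀ {q} → List (Fin q) → List (Fin q) → ℕ
editL [] ys = length ys
editL (x ∷ xs) [] = suc (length xs)
editL (x ∷ xs) (y ∷ ys) =
  (suc (editL xs (y ∷ ys)) ⊓ suc (editL (x ∷ xs) ys)) ⊓ (subCost x y + editL xs ys)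

Seq : ℕ → ℕ → Set
Seq q n = Vec (Fin q) n

edit : ∀ {q n} → Seq q n → Seq q n → ℕ
edit s t = editL (toList s) (toList t)

Subset : ℕ → ℕ → Set₁
Subset q n = Seq q n → Set

fB : ∀ {q n} → ℕ → Subset q n → Seq q n → Subset q n
fB r B s b = (edit s b ≤ r) × B b

Meets : ∀ {q n} → (Seq q n → Subset q n) → Seq q n → Seq q n → Set
Meets f s t = ∃ λ b → f s b × f t b

Sensitive : ∀ {q n} → ℕ → ℕ → (Seq q n → Subset q n) → Set
Sensitive {q} {n} d₁ d₂ f =
  (∀ (s t : Seq q n) → edit s t ≤ d₁ → Meets f s t) ×
  (∀ (s t : Seq q n) → d₂ ≤ edit s t → ¬ Meets f s t)

Guaranteed : ∀ {q n} → ℕ → ℕ → Subset q n → Set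
Guaranteed {q} {n} d₁ r B =
  ∀ (s t : Seq q n) → edit s t ≤ d₁ →
    ∃ λ b → (edit s b ≤ r) × (edit t b ≤ r) × B b

{-# OPTIONS --safe #-}
module Submission where

-- The recursive edit distance is the length of a shortest script of single deletions,
-- insertions and substitutions, so it is a metric, and radius-2 balls around words at
-- distance at least 5 are disjoint.
-- For words s, t of equal length at distance at most 3, the steps of such a script can be
-- rearranged so that a middle step a → b, with a or b of the common length, is preceded and
-- followed by at most one step. Varying the letter at the position of that middle step gives
-- a "line" of words, each within 1 of a and of b, hence within 2 of s and of t. As |Σ| > 1 a
-- line has two distinct points, at distance 1, so (1,1)-guaranteedness yields a bucket within
-- 1 of both; and a word within 1 of two distinct points of a line lies on the line.

open import Defs
open import Data.Nat using (ℕ; zero; suc; _+_; _≤_; _<_; _⊓_; z≤n; s≤s)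
open import Data.Nat.Properties
  using (≤-refl; ≤-reflexive; ≤-trans; n≤1+n; m≤m+n; m≤n+m; +-suc; +-comm; +-monoˡ-≤; +-monoʳ-≤; +-mono-≤;
         ≤-antisym; module ≤-Reasoning; ⊓-sel; ⊓-glb; ⊓-mono-≤; m⊓n≤m; m⊓n≤n; n≤0⇒n≡0; <⇒≱)
open import Data.Fin using (Fin; zero; suc)
open import Data.Fin.Properties using (_≟_)
open import Data.List using (length)
open import Data.Vec using ([]; _∷_; toList)
open import Data.Vec.Properties using (∷-injectiveˡ; ∷-injectiveʳ)
open import Data.Product using (Σ-syntax; ∃; _×_; _,_; proj₁; proj₂)
open import Data.Sum using (_⊎_; inj₁; inj₂)
open import Relation.Nullary using (¬_; yes; no; contradiction)
open import Relation.Binary.PropositionalEquality using (_≡_; _≢_; refl; sym; trans; cong; cong₂; subst)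

module _ {q : ℕ} where

  private
    variable
      a b k m n o : ℕ
      x y z : Fin q
      xs ys zs : Seq q m

  editDist : Seq q m → Seq q n → ℕ
  editDist xs ys = editL (toList xs) (toList ys)

  subCost≤1 : (x y : Fin q) → subCost x y ≤ 1
  subCost≤1 x y with x ≟ y
  ... | yes _ = z≤n
  ... | no  _ = ≤-refl

  subCost-refl : (x : Fin q) → subCost x x ≡ 0
  subCost-refl x with x ≟ x
  ... | yes _   = refl
  ... | no  x≢x = contradiction refl x≢x

  ⊓-closed : (P : ℕ → Set) → P a → P b → P (a ⊓ b)
  ⊓-closed {a} {b} P pa pb with ⊓-sel a b
  ... | inj₁ a⊓b≡a = subst P (sym a⊓b≡a) pa
  ... | inj₂ a⊓b≡b = subst P (sym a⊓b≡b) pb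

  -- `Edits k xs ys`: at most k single edits turn xs into ys. A substitution may keep the letter.

  data Del : Seq q (suc m) → Seq q m → Set where
    here  : Del (x ∷ xs) xs
    there : Del xs ys → Del (x ∷ xs) (x ∷ ys)

  data Sub : Seq q m → Seq q m → Set where
    here  : Sub (x ∷ xs) (y ∷ xs)
    there : Sub xs ys → Sub (x ∷ xs) (x ∷ ys)

  data Step : Seq q m → Seq q n → Set where
    del : Del xs ys → Step xs ys
    ins : Del ys xs → Step xs ys
    sub : Sub xs ys → Step xs ys

  data Edits : ℕ → Seq q m → Seq q n → Set where
    done : Edits k xs xs
    step : Step xs ys → Edits k ys zs → Edits (suc k) xs zs

  single : Step xs ys → Edits 1 xs ys
  single s = step s done

  Sub-refl : (xs : Seq q (suc m)) → Sub xs xs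
  Sub-refl (x ∷ xs) = here

  Sub-sym : Sub xs ys → Sub ys xs
  Sub-sym here      = here
  Sub-sym (there s) = there (Sub-sym s)

  Step-sym : Step xs ys → Step ys xs
  Step-sym (del d) = ins d
  Step-sym (ins d) = del d
  Step-sym (sub s) = sub (Sub-sym s)

  Step-∷ : Step xs ys → Step (x ∷ xs) (x ∷ ys)
  Step-∷ (del d) = del (there d)
  Step-∷ (ins d) = ins (there d)
  Step-∷ (sub s) = sub (there s)

  Edits-mono : a ≤ b → Edits a xs ys → Edits b xs ys
  Edits-mono _         done       = done
  Edits-mono (s≤s a≤b) (step s p) = step s (Edits-mono a≤b p)

  Edits-trans : Edits a xs ys → Edits b ys zs → Edits (a + b) xs zs
  Edits-trans {a} {b = b} done p = Edits-mono (m≤n+m b a) p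
  Edits-trans (step s p) r       = step s (Edits-trans p r)

  Edits-sym : Edits a xs ys → Edits a ys xs
  Edits-sym done                 = done
  Edits-sym {suc a} (step s p) =
    Edits-mono (≤-reflexive (+-comm a 1)) (Edits-trans (Edits-sym p) (single (Step-sym s)))

  Edits-∷ : Edits a xs ys → Edits a (x ∷ xs) (x ∷ ys)
  Edits-∷ done       = done
  Edits-∷ (step s p) = step (Step-∷ s) (Edits-∷ p)

  deleteAll : (xs : Seq q m) → Edits (length (toList xs)) xs []
  deleteAll []       = done
  deleteAll (x ∷ xs) = step (del here) (deleteAll xs)

  insertAll : (ys : Seq q n) → Edits (length (toList ys)) [] ys
  insertAll []       = done
  insertAll (y ∷ ys) = step (ins here) (Edits-∷ (insertAll ys))

  Edits-sub : (x y : Fin q) → Edits k xs ys → Edits (subCost x y + k) (x ∷ xs) (y ∷ ys)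
  Edits-sub x y p with x ≟ y
  ... | yes refl = Edits-∷ p
  ... | no  _    = step (sub here) (Edits-∷ p)

  Edits-editDist : (xs : Seq q m) (ys : Seq q n) → Edits (editDist xs ys) xs ys
  Edits-editDist []       ys       = insertAll ys
  Edits-editDist (x ∷ xs) []       = deleteAll (x ∷ xs)
  Edits-editDist (x ∷ xs) (y ∷ ys) =
    ⊓-closed (λ k → Edits k (x ∷ xs) (y ∷ ys))
      (⊓-closed (λ k → Edits k (x ∷ xs) (y ∷ ys))
        (step (del here) (Edits-editDist xs (y ∷ ys)))
        (step (ins here) (Edits-∷ (Edits-editDist (x ∷ xs) ys))))
      (Edits-sub x y (Edits-editDist xs ys))

  editDist≤⇒Edits : (xs : Seq q m) (ys : Seq q n) → editDist xs ys ≤ k → Edits k xs ys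
  editDist≤⇒Edits xs ys d≤k = Edits-mono d≤k (Edits-editDist xs ys)

  Lipschitz : Seq q m → Seq q n → Set
  Lipschitz ys zs = ∀ {o} (X : Seq q o) → editDist X zs ≤ suc (editDist X ys)

  editDist-∷ˡ : (x : Fin q) (xs : Seq q m) (ys : Seq q n) → editDist (x ∷ xs) ys ≤ suc (editDist xs ys)
  editDist-∷ˡ x []      []       = ≤-refl
  editDist-∷ˡ x (_ ∷ _) []       = ≤-refl
  editDist-∷ˡ x xs      (y ∷ ys) = ≤-trans (m⊓n≤m _ _) (m⊓n≤m _ _)

  editDist-∷∷ : (x : Fin q) (xs : Seq q m) (y : Fin q) (ys : Seq q n) →
                editDist (x ∷ xs) (y ∷ ys) ≤ suc (editDist xs ys)
  editDist-∷∷ x xs y ys = ≤-trans (m⊓n≤n _ _) (+-monoˡ-≤ (editDist xs ys) (subCost≤1 x y))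

  Lipschitz-ins : Lipschitz ys (y ∷ ys)
  Lipschitz-ins []      = ≤-refl
  Lipschitz-ins (x ∷ X) = ≤-trans (m⊓n≤m _ _) (m⊓n≤n _ _)

  Lipschitz-del : Lipschitz (y ∷ ys) ys
  Lipschitz-del []                  = ≤-trans (n≤1+n _) (n≤1+n _)
  Lipschitz-del {ys = ys} (x ∷ X) =
    ⊓-glb (⊓-glb (≤-trans (editDist-∷ˡ x X ys) (s≤s (Lipschitz-del X)))
                 (≤-trans (n≤1+n _) (n≤1+n _)))
          (≤-trans (editDist-∷ˡ x X ys) (s≤s (m≤n+m _ _)))

  Lipschitz-sub : Lipschitz (y ∷ ys) (z ∷ ys)
  Lipschitz-sub []                          = n≤1+n _
  Lipschitz-sub {y = y} {ys = ys} (x ∷ X) =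
    ⊓-glb (⊓-glb (≤-trans (editDist-∷ˡ x X _) (s≤s (Lipschitz-sub X)))
                 (≤-trans (Lipschitz-ins (x ∷ X)) (n≤1+n _)))
          (≤-trans (editDist-∷∷ x X _ ys) (s≤s (m≤n+m _ (subCost x y))))

  Lipschitz-∷ : Lipschitz ys zs → Lipschitz (y ∷ ys) (y ∷ zs)
  Lipschitz-∷ ys⇝zs []                    = s≤s (ys⇝zs [])
  Lipschitz-∷ {ys = ys} {y = y} ys⇝zs (x ∷ X) =
    ⊓-mono-≤ (⊓-mono-≤ (s≤s (Lipschitz-∷ ys⇝zs X)) (s≤s (ys⇝zs (x ∷ X))))
             (≤-trans (+-monoʳ-≤ (subCost x y) (ys⇝zs X))
                      (≤-reflexive (+-suc (subCost x y) (editDist X ys))))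

  Del-Lipschitz : Del ys zs → Lipschitz ys zs
  Del-Lipschitz here      = Lipschitz-del
  Del-Lipschitz (there d) = Lipschitz-∷ (Del-Lipschitz d)

  Ins-Lipschitz : Del zs ys → Lipschitz ys zs
  Ins-Lipschitz here      = Lipschitz-ins
  Ins-Lipschitz (there d) = Lipschitz-∷ (Ins-Lipschitz d)

  Sub-Lipschitz : Sub ys zs → Lipschitz ys zs
  Sub-Lipschitz here      = Lipschitz-sub
  Sub-Lipschitz (there s) = Lipschitz-∷ (Sub-Lipschitz s)

  Step-Lipschitz : Step ys zs → Lipschitz ys zs
  Step-Lipschitz (del d) = Del-Lipschitz d
  Step-Lipschitz (ins d) = Ins-Lipschitz d
  Step-Lipschitz (sub s) = Sub-Lipschitz s

  editDist-Edits : (X : Seq q o) → Edits a ys zs → editDist X zs ≤ editDist X ys + a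
  editDist-Edits {a = a} {ys = ys} X done = m≤m+n (editDist X ys) a
  editDist-Edits {a = suc a} {ys = ys} X (step s p) = begin
    editDist X _                ≤⟨ editDist-Edits X p ⟩
    editDist X _ + a            ≤⟨ +-monoˡ-≤ a (Step-Lipschitz s X) ⟩
    suc (editDist X ys) + a     ≡⟨ sym (+-suc (editDist X ys) a) ⟩
    editDist X ys + suc a       ∎
    where open ≤-Reasoning

  editDist-refl : (xs : Seq q m) → editDist xs xs ≡ 0
  editDist-refl []       = refl
  editDist-refl (x ∷ xs) =
    n≤0⇒n≡0 (≤-trans (m⊓n≤n _ _) (≤-reflexive (cong₂ _+_ (subCost-refl x) (editDist-refl xs))))

  Edits⇒editDist≤ : Edits a xs ys → editDist xs ys ≤ a
  Edits⇒editDist≤ {a = a} {xs = xs} p =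
    ≤-trans (editDist-Edits xs p) (≤-reflexive (cong (_+ a) (editDist-refl xs)))

  editDist-triangle : (xs : Seq q m) (ys : Seq q n) (zs : Seq q o) →
                      editDist xs zs ≤ editDist xs ys + editDist ys zs
  editDist-triangle xs ys zs = editDist-Edits xs (Edits-editDist ys zs)

  editDist-sym : (xs : Seq q m) (ys : Seq q n) → editDist xs ys ≡ editDist ys xs
  editDist-sym xs ys = ≤-antisym (sym-≤ xs ys) (sym-≤ ys xs)
    where
    sym-≤ : (xs : Seq q m) (ys : Seq q n) → editDist xs ys ≤ editDist ys xs
    sym-≤ xs ys = Edits⇒editDist≤ (Edits-sym (Edits-editDist ys xs))

  data IsLine : (Fin q → Seq q m) → Set where
    here  : (xs : Seq q m) → IsLine (λ c → c ∷ xs)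
    there : (x : Fin q) {L : Fin q → Seq q m} → IsLine L → IsLine (λ c → x ∷ L c)

  IsLine-injective : {L : Fin q → Seq q m} → IsLine L → {c c′ : Fin q} → L c ≡ L c′ → c ≡ c′
  IsLine-injective (here xs)   eq = ∷-injectiveˡ eq
  IsLine-injective (there x l) eq = IsLine-injective l (∷-injectiveʳ eq)

  IsLine-Sub : {L : Fin q → Seq q m} → IsLine L → (c c′ : Fin q) → Sub (L c) (L c′)
  IsLine-Sub (here xs)   c c′ = here
  IsLine-Sub (there x l) c c′ = there (IsLine-Sub l c c′)

  Edits₁-∷ : {xs ys : Seq q m} → Edits 1 (x ∷ xs) (y ∷ ys) → (x ≡ y × Edits 1 xs ys) ⊎ xs ≡ ys
  Edits₁-∷ done                        = inj₂ refl
  Edits₁-∷ (step (sub here) done)      = inj₂ refl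
  Edits₁-∷ (step (sub (there s)) done) = inj₁ (refl , single (sub s))

  Edits₁-line : {L : Fin q → Seq q m} → IsLine L → {c₀ c₁ : Fin q} → c₀ ≢ c₁ → {ys : Seq q m} →
                Edits 1 (L c₀) ys → Edits 1 (L c₁) ys → ∃ λ c → ys ≡ L c
  Edits₁-line (here xs) c₀≢c₁ {y ∷ ys} p₀ p₁ with Edits₁-∷ p₀ | Edits₁-∷ p₁
  ... | inj₂ xs≡ys      | _               = y , cong (y ∷_) (sym xs≡ys)
  ... | inj₁ _          | inj₂ xs≡ys      = y , cong (y ∷_) (sym xs≡ys)
  ... | inj₁ (c₀≡y , _) | inj₁ (c₁≡y , _) = contradiction (trans c₀≡y (sym c₁≡y)) c₀≢c₁
  Edits₁-line (there x l) c₀≢c₁ {y ∷ ys} p₀ p₁ with Edits₁-∷ p₀ | Edits₁-∷ p₁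
  ... | inj₁ (x≡y , _) | inj₂ Lc₁≡ys = _ , cong₂ _∷_ (sym x≡y) (sym Lc₁≡ys)
  ... | inj₂ Lc₀≡ys    | inj₁ (x≡y , _) = _ , cong₂ _∷_ (sym x≡y) (sym Lc₀≡ys)
  ... | inj₂ Lc₀≡ys    | inj₂ Lc₁≡ys =
    contradiction (IsLine-injective l (trans Lc₀≡ys (sym Lc₁≡ys))) c₀≢c₁
  ... | inj₁ (x≡y , p₀′) | inj₁ (_ , p₁′) with Edits₁-line l c₀≢c₁ p₀′ p₁′
  ...   | c , ys≡Lc = c , cong₂ _∷_ (sym x≡y) ys≡Lc

  Sub-line : {xs ys : Seq q m} → Sub xs ys →
             Σ[ L ∈ (Fin q → Seq q m) ] IsLine L × (∀ c → Sub xs (L c)) × (∀ c → Sub ys (L c))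
  Sub-line (here {xs = xs}) = (λ c → c ∷ xs) , here xs , (λ _ → here) , (λ _ → here)
  Sub-line (there {x = x} s) with Sub-line s
  ... | L , l , xs~L , ys~L =
    (λ c → x ∷ L c) , there x l , (λ c → there (xs~L c)) , (λ c → there (ys~L c))

  Del-line : {xs : Seq q (suc m)} {ys : Seq q m} → Del xs ys →
             Σ[ L ∈ (Fin q → Seq q (suc m)) ] IsLine L × (∀ c → Sub xs (L c)) × (∀ c → Del (L c) ys)
  Del-line (here {xs = xs}) = (λ c → c ∷ xs) , here xs , (λ _ → here) , (λ _ → here)
  Del-line (there {x = x} d) with Del-line d
  ... | L , l , xs~L , L~ys =
    (λ c → x ∷ L c) , there x l , (λ c → there (xs~L c)) , (λ c → there (L~ys c))

  SharedLine : Seq q m → Seq q m → Set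
  SharedLine {m} s t = Σ[ L ∈ (Fin q → Seq q m) ] IsLine L × (∀ c → Edits 2 s (L c) × Edits 2 t (L c))

  data Pivot : Seq q m → Seq q m → Set where
    via-sub : {s a b t : Seq q m} → Edits 1 s a → Sub a b → Edits 1 b t → Pivot s t
    via-del : {s a t : Seq q (suc m)} {b : Seq q m} → Edits 1 s a → Del a b → Edits 1 b t → Pivot s t
    via-ins : {s b t : Seq q (suc m)} {a : Seq q m} → Edits 1 s a → Del b a → Edits 1 b t → Pivot s t

  line-between : {s t : Seq q m} {a : Seq q n} {b : Seq q o} {L : Fin q → Seq q m} →
                 Edits 1 s a → IsLine L → (∀ c → Edits 1 a (L c)) → (∀ c → Edits 1 b (L c)) →
                 Edits 1 b t → SharedLine s t
  line-between {L = L} s⇝a l a⇝L b⇝L b⇝t =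
    L , l , λ c → Edits-trans s⇝a (a⇝L c) , Edits-trans (Edits-sym b⇝t) (b⇝L c)

  Pivot-SharedLine : {s t : Seq q m} → Pivot s t → SharedLine s t
  Pivot-SharedLine (via-sub s⇝a a~b b⇝t) with Sub-line a~b
  ... | L , l , a~L , b~L =
    line-between s⇝a l (λ c → single (sub (a~L c))) (λ c → single (sub (b~L c))) b⇝t
  Pivot-SharedLine (via-del s⇝a a↦b b⇝t) with Del-line a↦b
  ... | L , l , a~L , L↦b =
    line-between s⇝a l (λ c → single (sub (a~L c))) (λ c → single (ins (L↦b c))) b⇝t
  Pivot-SharedLine (via-ins s⇝a b↦a b⇝t) with Del-line b↦a
  ... | L , l , b~L , L↦a =
    line-between s⇝a l (λ c → single (ins (L↦a c))) (λ c → single (sub (b~L c))) b⇝t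

  data CommonDel : Seq q m → Seq q m → Set where
    common : {xs ys : Seq q (suc m)} {zs : Seq q m} → Del xs zs → Del ys zs → CommonDel xs ys

  ins-del⇒del-ins : {xs : Seq q (suc m)} {ys zs : Seq q m} → Del xs ys → Del xs zs →
                    ys ≡ zs ⊎ CommonDel ys zs
  ins-del⇒del-ins here      here      = inj₁ refl
  ins-del⇒del-ins here      (there d) = inj₂ (common d here)
  ins-del⇒del-ins (there d) here      = inj₂ (common here d)
  ins-del⇒del-ins (there d₁) (there d₂) with ins-del⇒del-ins d₁ d₂
  ... | inj₁ eq              = inj₁ (cong (_ ∷_) eq)
  ... | inj₂ (common e₁ e₂) = inj₂ (common (there e₁) (there e₂))

  sub-ins⇒ins-sub : {xs ys : Seq q m} {zs : Seq q (suc m)} → Sub xs ys → Del zs ys →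
                    Σ[ ys′ ∈ Seq q (suc m) ] Del ys′ xs × Sub ys′ zs
  sub-ins⇒ins-sub (here {x = x} {xs = xs}) (here {x = z})    = z ∷ x ∷ xs , here , there here
  sub-ins⇒ins-sub (here {x = x}) (there {xs = zs} d)          = x ∷ zs , there d , here
  sub-ins⇒ins-sub (there {xs = xs} {x = x} s) (here {x = z}) = z ∷ x ∷ xs , here , there (there s)
  sub-ins⇒ins-sub (there {x = x} s) (there d) with sub-ins⇒ins-sub s d
  ... | ys′ , d′ , s′ = x ∷ ys′ , there d′ , there s′

  ins-sub⇒sub-ins : {xs : Seq q m} {ys zs : Seq q (suc m)} → Del ys xs → Sub ys zs →
                    Σ[ xs′ ∈ Seq q m ] Edits 1 xs xs′ × Del zs xs′
  ins-sub⇒sub-ins {xs = xs} here here                 = xs , done , here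
  ins-sub⇒sub-ins here (there {ys = zs} s)            = zs , single (sub s) , here
  ins-sub⇒sub-ins (there {ys = xs} d) (here {y = z}) = z ∷ xs , single (sub here) , there d
  ins-sub⇒sub-ins (there {x = x} d) (there s) with ins-sub⇒sub-ins d s
  ... | xs′ , p , d′ = x ∷ xs′ , Edits-∷ p , there d′

  -- Equal lengths force equally many insertions and deletions, which leaves these scripts.
  pivot : {s t : Seq q (suc m)} → Edits 3 s t → Pivot s t
  pivot {s = s} done = via-sub done (Sub-refl s) done
  pivot (step (sub s₁) done) = via-sub done s₁ done
  pivot (step (sub s₁) (step (sub s₂) done)) = via-sub done s₁ (single (sub s₂))
  pivot (step (sub s₁) (step (sub s₂) (step (sub s₃) done))) =
    via-sub (single (sub s₁)) s₂ (single (sub s₃))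
  pivot (step (del d) (step (ins i) done)) = via-del done d (single (ins i))
  pivot (step (sub s) (step (del d) (step (ins i) done))) = via-del (single (sub s)) d (single (ins i))
  pivot (step (del d) (step (ins i) (step (sub s) done))) = via-ins (single (del d)) i (single (sub s))
  pivot (step (ins i) (step (del d) done)) with ins-del⇒del-ins i d
  ... | inj₁ refl           = via-sub done (Sub-refl _) done
  ... | inj₂ (common d₁ d₂) = via-del done d₁ (single (ins d₂))
  pivot (step (sub s) (step (ins i) (step (del d) done))) with ins-del⇒del-ins i d
  ... | inj₁ refl           = via-sub done s done
  ... | inj₂ (common d₁ d₂) = via-del (single (sub s)) d₁ (single (ins d₂))
  pivot (step (ins i) (step (del d) (step (sub s) done))) with ins-del⇒del-ins i d
  ... | inj₁ refl           = via-sub done s done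
  ... | inj₂ (common d₁ d₂) = via-ins (single (del d₁)) d₂ (single (sub s))
  pivot (step (del d) (step (sub s) (step (ins i) done))) with sub-ins⇒ins-sub s i
  ... | _ , i′ , s′ = via-ins (single (del d)) i′ (single (sub s′))
  pivot (step (ins i) (step (sub s) (step (del d) done))) with ins-sub⇒sub-ins i s
  ... | _ , p , i′ with ins-del⇒del-ins i′ d
  ...   | inj₁ refl           = via-sub p (Sub-refl _) done
  ...   | inj₂ (common d₁ d₂) = via-del p d₁ (single (ins d₂))

  IsLine-meets-guaranteed : {B : Subset q m} → Guaranteed 1 1 B → {L : Fin q → Seq q m} → IsLine L →
                            {c₀ c₁ : Fin q} → c₀ ≢ c₁ → ∃ λ c → B (L c)
  IsLine-meets-guaranteed guaranteed {L} l {c₀} {c₁} c₀≢c₁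
    with guaranteed (L c₀) (L c₁) (Edits⇒editDist≤ (single (sub (IsLine-Sub l c₀ c₁))))
  ... | b , d₀ , d₁ , b∈B with Edits₁-line l c₀≢c₁ (editDist≤⇒Edits _ _ d₀) (editDist≤⇒Edits _ _ d₁)
  ...   | c , refl = c , b∈B

  fB-near : {B : Subset q (suc m)} → Guaranteed 1 1 B → {c₀ c₁ : Fin q} → c₀ ≢ c₁ →
            (s t : Seq q (suc m)) → edit s t ≤ 3 → Meets (fB 2 B) s t
  fB-near guaranteed c₀≢c₁ s t d≤3 with Pivot-SharedLine (pivot (editDist≤⇒Edits s t d≤3))
  ... | L , l , near with IsLine-meets-guaranteed guaranteed l c₀≢c₁
  ...   | c , Lc∈B =
    L c , (Edits⇒editDist≤ (proj₁ (near c)) , Lc∈B) , (Edits⇒editDist≤ (proj₂ (near c)) , Lc∈B)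

  fB-far : (r : ℕ) (B : Subset q m) (s t : Seq q m) → suc (r + r) ≤ edit s t → ¬ Meets (fB r B) s t
  fB-far r B s t 2r<d (b , (d₁ , _) , (d₂ , _)) = <⇒≱ 2r<d (begin
    editDist s t                 ≤⟨ editDist-triangle s b t ⟩
    editDist s b + editDist b t  ≡⟨ cong (editDist s b +_) (editDist-sym b t) ⟩
    editDist s b + editDist t b  ≤⟨ +-mono-≤ d₁ d₂ ⟩
    r + r                        ∎)
    where open ≤-Reasoning

theorem2 : (q n : ℕ) → 1 < q → 1 ≤ n → (B : Subset q n) →
    Guaranteed 1 1 B → Sensitive 3 5 (fB 2 B)
theorem2 (suc (suc q)) (suc n) (s≤s (s≤s z≤n)) (s≤s z≤n) B guaranteed =
  fB-near guaranteed {zero} {suc zero} (λ ()) , fB-far 2 B
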